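{- Let $i$ and $j$ be positive integers and let $G$ be an $\langle i,j\rangle$ competition graph. Then (a) $|E(G)|\le \frac{(i-1)i}{2}|V(G)|$; (b) $G$ has no induced subgraph isomorphic to $K_{1,j+1}$; (c) $\Delta(G)\le j(i-1)$, where $\Delta(G)$ is the maximum degree of $G$.
   Context: All digraphs are finite, without loops and without parallel arcs; all graphs are finite and simple. The competition graph of a digraph $D$ has vertex set $V(D)$ and an edge $uv$ ($u\ne v$) iff $u$ and $v$ have a common out-neighbor in $D$. For positive integers $i,j$, an $\langle i,j\rangle$ digraph is a loopless digraph in which every vertex has indegree at most $i$ and outdegree at most $j$ (not necessarily acyclic). An $\langle i,j\rangle$ competition graph is the competition graph of some $\langle i,j\rangle$ digraph. -}

module Defs where

open import Data.Nat using (ℕ; zero; suc; _+_; _<ᵇ_)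
open import Data.Bool using (Bool; true; false; if_then_else_; _∧_)
open import Data.Fin using (Fin; toℕ)
open import Data.List using (List; map)
open import Data.Nat.ListAction using (sum)
open import Data.Bool.ListAction using (any)
open import Data.List using () renaming (allFin to allFinL)
open import Relation.Binary.PropositionalEquality using (_≡_)

count : {n : ℕ} → (Fin n → Bool) → ℕ
count {n} p = sum (map (λ x → if p x then 1 else 0) (allFinL n))

record Digraph (n : ℕ) : Set where
  field
    arc      : Fin n → Fin n → Bool
    loopless : ∀ v → arc v v ≡ false
open Digraph public

outdeg : {n : ℕ} → Digraph n → Fin n → ℕ
outdeg D v = count (λ w → arc D v w)

indeg : {n : ℕ} → Digraph n → Fin n → ℕ
indeg D v = count (λ u → arc D u v)

open import Data.Nat using (_≤_)
open import Data.Product using (_×_)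

IsIJDigraph : ℕ → ℕ → {n : ℕ} → Digraph n → Set
IsIJDigraph i j {n} D = ∀ (v : Fin n) → (indeg D v ≤ i) × (outdeg D v ≤ j)

record Graph (n : ℕ) : Set where
  field
    adj    : Fin n → Fin n → Bool
    sym    : ∀ u v → adj u v ≡ adj v u
    irrefl : ∀ v → adj v v ≡ false
open Graph public

open import Data.Fin using (_≟_)
open import Relation.Nullary.Decidable using (⌊_⌋)
open import Data.Bool using (not)

compAdj : {n : ℕ} → Digraph n → Fin n → Fin n → Bool
compAdj {n} D u v = not ⌊ u ≟ v ⌋ ∧ any (λ w → arc D u w ∧ arc D v w) (allFinL n)

IsCompetitionGraphOf : {n : ℕ} → Graph n → Digraph n → Set
IsCompetitionGraphOf {n} G D = ∀ (u v : Fin n) → adj G u v ≡ compAdj D u v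

open import Data.Product using (Σ-syntax)

IsIJCompetitionGraph : ℕ → ℕ → {n : ℕ} → Graph n → Set
IsIJCompetitionGraph i j {n} G =
  Σ[ D ∈ Digraph n ] (IsIJDigraph i j D × IsCompetitionGraphOf G D)

deg : {n : ℕ} → Graph n → Fin n → ℕ
deg G v = count (λ w → adj G v w)

edgeCount : {n : ℕ} → Graph n → ℕ
edgeCount {n} G = sum (map (λ u → count (λ v → (toℕ u <ᵇ toℕ v) ∧ adj G u v)) (allFinL n))

open import Relation.Nullary using (¬_)
open import Function.Definitions using (Injective)

HasInducedStar : {n : ℕ} → Graph n → ℕ → Set
HasInducedStar {n} G m =
  Σ[ c ∈ Fin n ] Σ[ f ∈ (Fin m → Fin n) ]
    ( Injective _≡_ _≡_ f
    × (∀ k → adj G c (f k) ≡ true)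
    × (∀ k l → ¬ (k ≡ l) → adj G (f k) (f l) ≡ false))

-- Every edge uv of the competition graph of D comes from a common out-neighbour x of u and v,
-- i.e. lies inside the in-neighbourhood of x, which has at most i vertices.  Hence the edges
-- are covered by the pairs inside the n in-neighbourhoods, giving |E| ≤ n·C(i,2); the
-- neighbours of v are covered by the in-neighbourhoods of the at most j out-neighbours of v,
-- each contributing at most i − 1 vertices besides v.  For an induced star with centre c
-- and leaves ℓ₀, …, ℓⱼ, choosing a common out-neighbour xₖ of c and ℓₖ gives j + 1 distinct
-- out-neighbours of c: if xₖ = xₗ then ℓₖ and ℓₗ would be adjacent.
module Submission where

open import Defs hiding (sym)
open import Data.Nat using (ℕ; suc; _*_; _∸_; _≤_)
open import Data.Fin using (Fin)
open import Data.Product using (_×_)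
open import Relation.Nullary using (¬_)

open import Data.Bool using (Bool; true; false; if_then_else_; _∧_; not)
open import Data.Bool.ListAction using (any)
open import Data.Bool.Properties using (T-≡; ∧-identityʳ; ∧-zeroʳ; not-¬)
open import Data.Fin using (toℕ; _≟_; zero; punchIn) renaming (suc to fsuc)
open import Data.Fin.Properties using (punchInᵢ≢i) renaming (suc-injective to fsuc-injective)
open import Data.List using (map; allFin; tabulate)
open import Data.List.Membership.Propositional using (lose)
open import Data.List.Membership.Propositional.Properties using (∈-allFin)
open import Data.List.Properties using (map-tabulate)
open import Data.List.Relation.Unary.Any using (satisfied)
open import Data.List.Relation.Unary.Any.Properties using (any⁺; any⁻)
open import Data.Nat using (zero; _+_; _<ᵇ_; z≤n; s≤s)
open import Data.Nat.ListAction using () renaming (sum to listSum)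
open import Data.Nat.Properties
  using (+-*-semiring; ≤-trans; ≤-reflexive; m≤m+n; +-mono-≤; *-mono-≤; *-monoˡ-≤;
         *-monoʳ-≤; *-identityˡ; ∸-monoˡ-≤; *-distribʳ-+; *-comm; 1+n≰n; module ≤-Reasoning)
open import Data.Nat.Tactic.RingSolver using (solve-∀)
open import Data.Product using (_,_; proj₁; proj₂; ∃-syntax)
open import Function using (_∘_; Equivalence)
open import Function.Definitions using (Injective)
open import Relation.Binary.PropositionalEquality
  using (_≡_; _≢_; refl; sym; trans; cong; cong₂; subst; module ≡-Reasoning)
open import Relation.Nullary using (yes; no; contradiction)
open import Relation.Nullary.Decidable using (⌊_⌋)

open import Algebra.Properties.Semiring.Sum +-*-semiring
  using (sum-syntax; sum-cong-≗; sum-remove; sum-replicate-zero; ∑-comm; *-distribʳ-sum)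

private
  variable
    m n : ℕ

∑-mono-≤ : {f g : Fin n → ℕ} → (∀ x → f x ≤ g x) → ∑[ x < n ] f x ≤ ∑[ x < n ] g x
∑-mono-≤ {zero}  f≤g = z≤n
∑-mono-≤ {suc n} f≤g = +-mono-≤ (f≤g zero) (∑-mono-≤ (f≤g ∘ fsuc))

term≤∑ : (f : Fin n → ℕ) (x : Fin n) → f x ≤ ∑[ y < n ] f y
term≤∑ {suc n} f x = ≤-trans (m≤m+n (f x) _) (≤-reflexive (sym (sum-remove {i = x} f)))

∑-const : ∀ n c → ∑[ x < n ] c ≡ n * c
∑-const zero    c = refl
∑-const (suc n) c = cong (c +_) (∑-const n c)

sum-map-allFin : (f : Fin n → ℕ) → listSum (map f (allFin n)) ≡ ∑[ x < n ] f x
sum-map-allFin {n} f = trans (cong listSum (map-tabulate (λ x → x) f)) (sum-tabulate f)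
  where
  sum-tabulate : ∀ {n} (f : Fin n → ℕ) → listSum (tabulate f) ≡ ∑[ x < n ] f x
  sum-tabulate {zero}  f = refl
  sum-tabulate {suc n} f = cong (f zero +_) (sum-tabulate (f ∘ fsuc))

any-allFin⁻ : (h : Fin n → Bool) → any h (allFin n) ≡ true → ∃[ x ] h x ≡ true
any-allFin⁻ {n} h e =
  let x , hx = satisfied (any⁻ h (allFin n) (Equivalence.from T-≡ e))
  in x , Equivalence.to T-≡ hx

any-allFin⁺ : (h : Fin n → Bool) (x : Fin n) → h x ≡ true → any h (allFin n) ≡ true
any-allFin⁺ h x hx = Equivalence.to T-≡ (any⁺ h (lose (∈-allFin x) (Equivalence.from T-≡ hx)))

∧≡true⁻ : ∀ {a b} → a ∧ b ≡ true → a ≡ true × b ≡ true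
∧≡true⁻ {true} b≡true = refl , b≡true

∧≡true⁺ : ∀ {a b} → a ≡ true → b ≡ true → a ∧ b ≡ true
∧≡true⁺ refl b≡true = b≡true

indicator : Bool → ℕ
indicator b = if b then 1 else 0

count≡∑ : (p : Fin n → Bool) → count p ≡ ∑[ x < n ] indicator (p x)
count≡∑ p = sum-map-allFin (indicator ∘ p)

count-suc : (p : Fin (suc n) → Bool) → count p ≡ indicator (p zero) + count (p ∘ fsuc)
count-suc p = trans (count≡∑ p) (cong (indicator (p zero) +_) (sym (count≡∑ (p ∘ fsuc))))

count-∧ˡ : (b : Bool) (q : Fin n → Bool) → count (λ w → b ∧ q w) ≡ indicator b * count q
count-∧ˡ {n} false q = trans (count≡∑ {n} (λ _ → false)) (sum-replicate-zero n)
count-∧ˡ       true  q = sym (*-identityˡ (count q))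

count-cover : (p : Fin n → Bool) (r : Fin m → Fin n → Bool) →
  (∀ w → p w ≡ true → ∃[ x ] r x w ≡ true) → count p ≤ ∑[ x < m ] count (r x)
count-cover {n} {m} p r covered = begin
  count p                                     ≡⟨ count≡∑ p ⟩
  ∑[ w < n ] indicator (p w)                  ≤⟨ ∑-mono-≤ covered-once ⟩
  ∑[ w < n ] ∑[ x < m ] indicator (r x w)     ≡⟨ ∑-comm (λ w x → indicator (r x w)) ⟩
  ∑[ x < m ] ∑[ w < n ] indicator (r x w)     ≡⟨ sum-cong-≗ (λ x → count≡∑ (r x)) ⟨
  ∑[ x < m ] count (r x)                      ∎
  where
  open ≤-Reasoning
  covered-once : ∀ w → indicator (p w) ≤ ∑[ x < m ] indicator (r x w)
  covered-once w with p w in pw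
  ... | false = z≤n
  ... | true  = let x , rxw = covered w pw in
    ≤-trans (≤-reflexive (cong indicator (sym rxw))) (term≤∑ (λ y → indicator (r y w)) x)

⌊≟⌋-≢ : {v w : Fin n} → v ≢ w → ⌊ v ≟ w ⌋ ≡ false
⌊≟⌋-≢ {v = v} {w} v≢w with v ≟ w
... | yes v≡w = contradiction v≡w v≢w
... | no  _   = refl

_∖_ : (Fin n → Bool) → Fin n → Fin n → Bool
(p ∖ v) w = p w ∧ not ⌊ v ≟ w ⌋

∖-self : (p : Fin n → Bool) (v : Fin n) → (p ∖ v) v ≡ false
∖-self p v with v ≟ v
... | yes _  = ∧-zeroʳ (p v)
... | no v≢v = contradiction refl v≢v

∖-other : (p : Fin n → Bool) {v w : Fin n} → v ≢ w → (p ∖ v) w ≡ p w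
∖-other p {w = w} v≢w = trans (cong (λ b → p w ∧ not b) (⌊≟⌋-≢ v≢w)) (∧-identityʳ (p w))

count-∖ : (p : Fin n → Bool) (v : Fin n) → p v ≡ true → suc (count (p ∖ v)) ≡ count p
count-∖ {suc n} p v pv = begin
  suc (count (p ∖ v))
    ≡⟨ cong suc (count≡∑ (p ∖ v)) ⟩
  suc (∑[ w < suc n ] indicator ((p ∖ v) w))
    ≡⟨ cong suc (sum-remove {i = v} (indicator ∘ (p ∖ v))) ⟩
  suc (indicator ((p ∖ v) v) + off-v (p ∖ v))
    ≡⟨ cong (λ b → suc (indicator b + off-v (p ∖ v))) (∖-self p v) ⟩
  suc (off-v (p ∖ v))
    ≡⟨ cong suc (sum-cong-≗ (λ k → cong indicator (∖-other p (punchInᵢ≢i v k ∘ sym)))) ⟩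
  suc (off-v p)
    ≡⟨ cong (λ b → indicator b + off-v p) pv ⟨
  indicator (p v) + off-v p
    ≡⟨ sum-remove {i = v} (indicator ∘ p) ⟨
  ∑[ w < suc n ] indicator (p w)
    ≡⟨ count≡∑ p ⟨
  count p
    ∎
  where
  open ≡-Reasoning
  off-v : (Fin (suc n) → Bool) → ℕ
  off-v q = ∑[ k < n ] indicator (q (punchIn v k))

count-≥-injection : (p : Fin n → Bool) (g : Fin m → Fin n) → Injective _≡_ _≡_ g →
  (∀ k → p (g k) ≡ true) → m ≤ count p
count-≥-injection {m = zero}  p g g-inj g∈p = z≤n
count-≥-injection {m = suc m} p g g-inj g∈p = begin
  suc m
    ≤⟨ s≤s (count-≥-injection (p ∖ g zero) (g ∘ fsuc) (fsuc-injective ∘ g-inj) g∘suc∈p∖g0) ⟩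
  suc (count (p ∖ g zero))
    ≡⟨ count-∖ p (g zero) (g∈p zero) ⟩
  count p
    ∎
  where
  open ≤-Reasoning
  g∘suc∈p∖g0 : ∀ k → (p ∖ g zero) (g (fsuc k)) ≡ true
  g∘suc∈p∖g0 k = trans (∖-other p (λ e → contradiction (g-inj e) λ ())) (g∈p (fsuc k))

n*2+n*[n∸1]≡[1+n]*n : ∀ n → n * 2 + n * (n ∸ 1) ≡ suc n * n
n*2+n*[n∸1]≡[1+n]*n zero    = refl
n*2+n*[n∸1]≡[1+n]*n (suc n) = identity n
  where
  identity : ∀ n → suc n * 2 + suc n * n ≡ suc (suc n) * suc n
  identity = solve-∀

pairs : (Fin n → Bool) → ℕ
pairs {n} p = ∑[ u < n ] (indicator (p u) * count (λ v → (toℕ u <ᵇ toℕ v) ∧ p v))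

pairs-suc : (p : Fin (suc n) → Bool) →
  pairs p ≡ indicator (p zero) * count (p ∘ fsuc) + pairs (p ∘ fsuc)
pairs-suc p =
  cong₂ _+_ (cong (indicator (p zero) *_) (count-suc (later-than zero)))
            (sum-cong-≗ (λ u → cong (indicator (p (fsuc u)) *_) (count-suc (later-than (fsuc u)))))
  where
  later-than : Fin _ → Fin _ → Bool
  later-than u v = (toℕ u <ᵇ toℕ v) ∧ p v

pairs*2 : (p : Fin n → Bool) → pairs p * 2 ≡ count p * (count p ∸ 1)
pairs*2 {zero}  p = refl
pairs*2 {suc n} p rewrite pairs-suc p | count-suc p with p zero
... | false = pairs*2 (p ∘ fsuc)
... | true  = begin
  (1 * c + pairs (p ∘ fsuc)) * 2      ≡⟨ *-distribʳ-+ 2 (1 * c) _ ⟩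
  1 * c * 2 + pairs (p ∘ fsuc) * 2    ≡⟨ cong (1 * c * 2 +_) (pairs*2 (p ∘ fsuc)) ⟩
  1 * c * 2 + c * (c ∸ 1)             ≡⟨ cong (λ k → k * 2 + c * (c ∸ 1)) (*-identityˡ c) ⟩
  c * 2 + c * (c ∸ 1)                 ≡⟨ n*2+n*[n∸1]≡[1+n]*n c ⟩
  suc c * c                           ∎
  where
  open ≡-Reasoning
  c = count (p ∘ fsuc)

inNeighbour : Digraph n → Fin n → Fin n → Bool
inNeighbour D x u = arc D u x

adj⇒≢ : (G : Graph n) {u v : Fin n} → adj G u v ≡ true → u ≢ v
adj⇒≢ G {u} uv refl = contradiction uv (not-¬ (irrefl G u))

module CompetitionGraph {n : ℕ} (G : Graph n) (D : Digraph n) (G≡C[D] : IsCompetitionGraphOf G D)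
  where

  adj⇒common-out-neighbour : ∀ {u v} → adj G u v ≡ true →
    ∃[ x ] (arc D u x ≡ true × arc D v x ≡ true)
  adj⇒common-out-neighbour {u} {v} uv =
    let x , ux∧vx = any-allFin⁻ _ (proj₂ (∧≡true⁻ {not ⌊ u ≟ v ⌋} (trans (sym (G≡C[D] u v)) uv)))
    in x , ∧≡true⁻ ux∧vx

  common-out-neighbour⇒adj : ∀ {u v x} → u ≢ v → arc D u x ≡ true → arc D v x ≡ true →
    adj G u v ≡ true
  common-out-neighbour⇒adj {u} {v} {x} u≢v ux vx =
    trans (G≡C[D] u v) (∧≡true⁺ (cong not (⌊≟⌋-≢ u≢v))
                               (any-allFin⁺ (λ y → arc D u y ∧ arc D v y) x (∧≡true⁺ ux vx)))

  edgeCount≤∑pairs : edgeCount G ≤ ∑[ x < n ] pairs (inNeighbour D x)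
  edgeCount≤∑pairs = begin
    edgeCount G
      ≡⟨ sum-map-allFin (λ u → count (λ v → u<v u v ∧ adj G u v)) ⟩
    ∑[ u < n ] count (λ v → u<v u v ∧ adj G u v)
      ≤⟨ ∑-mono-≤ (λ u → count-cover _ (r u) (covered u)) ⟩
    ∑[ u < n ] ∑[ x < n ] count (r u x)
      ≡⟨ sum-cong-≗ (λ u → sum-cong-≗ (λ x → count-∧ˡ (arc D u x) (inAfter u x))) ⟩
    ∑[ u < n ] ∑[ x < n ] (indicator (arc D u x) * count (inAfter u x))
      ≡⟨ ∑-comm (λ u x → indicator (arc D u x) * count (inAfter u x)) ⟩
    ∑[ x < n ] pairs (inNeighbour D x)
      ∎
    where
    open ≤-Reasoning
    u<v : Fin n → Fin n → Bool
    u<v u v = toℕ u <ᵇ toℕ v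
    inAfter : Fin n → Fin n → Fin n → Bool
    inAfter u x v = u<v u v ∧ arc D v x
    r : Fin n → Fin n → Fin n → Bool
    r u x v = arc D u x ∧ inAfter u x v
    covered : ∀ u v → u<v u v ∧ adj G u v ≡ true → ∃[ x ] r u x v ≡ true
    covered u v e =
      let u<v , uv = ∧≡true⁻ e
          x , ux , vx = adj⇒common-out-neighbour uv
      in x , ∧≡true⁺ ux (∧≡true⁺ u<v vx)

  module _ {i j : ℕ} (ij : IsIJDigraph i j D) where

    edgeCount*2≤ : edgeCount G * 2 ≤ (i ∸ 1) * i * n
    edgeCount*2≤ = begin
      edgeCount G * 2
        ≤⟨ *-monoˡ-≤ 2 edgeCount≤∑pairs ⟩
      (∑[ x < n ] pairs (inNeighbour D x)) * 2
        ≡⟨ *-distribʳ-sum 2 (λ x → pairs (inNeighbour D x)) ⟩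
      ∑[ x < n ] (pairs (inNeighbour D x) * 2)
        ≡⟨ sum-cong-≗ (λ x → pairs*2 (inNeighbour D x)) ⟩
      ∑[ x < n ] (indeg D x * (indeg D x ∸ 1))
        ≤⟨ ∑-mono-≤ (λ x → *-mono-≤ (indeg≤ x) (∸-monoˡ-≤ 1 (indeg≤ x))) ⟩
      ∑[ x < n ] (i * (i ∸ 1))
        ≡⟨ ∑-const n (i * (i ∸ 1)) ⟩
      n * (i * (i ∸ 1))
        ≡⟨ *-comm n (i * (i ∸ 1)) ⟩
      i * (i ∸ 1) * n
        ≡⟨ cong (_* n) (*-comm i (i ∸ 1)) ⟩
      (i ∸ 1) * i * n
        ∎
      where
      open ≤-Reasoning
      indeg≤ : ∀ x → indeg D x ≤ i
      indeg≤ x = proj₁ (ij x)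

    deg≤ : ∀ v → deg G v ≤ j * (i ∸ 1)
    deg≤ v = begin
      deg G v
        ≤⟨ count-cover (adj G v) r covered ⟩
      ∑[ x < n ] count (r x)
        ≡⟨ sum-cong-≗ (λ x → count-∧ˡ (arc D v x) (inNeighbour D x ∖ v)) ⟩
      ∑[ x < n ] (indicator (arc D v x) * count (inNeighbour D x ∖ v))
        ≤⟨ ∑-mono-≤ (λ x → others≤ (arc D v x) refl) ⟩
      ∑[ x < n ] (indicator (arc D v x) * (i ∸ 1))
        ≡⟨ *-distribʳ-sum (i ∸ 1) (λ x → indicator (arc D v x)) ⟨
      (∑[ x < n ] indicator (arc D v x)) * (i ∸ 1)
        ≡⟨ cong (_* (i ∸ 1)) (count≡∑ (arc D v)) ⟨
      outdeg D v * (i ∸ 1)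
        ≤⟨ *-monoˡ-≤ (i ∸ 1) (proj₂ (ij v)) ⟩
      j * (i ∸ 1)
        ∎
      where
      open ≤-Reasoning
      r : Fin n → Fin n → Bool
      r x w = arc D v x ∧ (inNeighbour D x ∖ v) w
      covered : ∀ w → adj G v w ≡ true → ∃[ x ] r x w ≡ true
      covered w vw =
        let x , vx , wx = adj⇒common-out-neighbour vw
        in x , ∧≡true⁺ vx (trans (∖-other (inNeighbour D x) (adj⇒≢ G vw)) wx)
      others≤ : ∀ {x} b → b ≡ arc D v x →
        indicator b * count (inNeighbour D x ∖ v) ≤ indicator b * (i ∸ 1)
      others≤     false _  = z≤n
      others≤ {x} true  vx = *-monoʳ-≤ 1
        (∸-monoˡ-≤ 1 (≤-trans (≤-reflexive (count-∖ (inNeighbour D x) v (sym vx))) (proj₁ (ij x))))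

    no-induced-star : ¬ HasInducedStar G (suc j)
    no-induced-star (c , ℓ , ℓ-inj , cℓ , ℓ≁ℓ) =
      1+n≰n (≤-trans (count-≥-injection (arc D c) x x-inj c→x) (proj₂ (ij c)))
      where
      common : ∀ k → ∃[ y ] (arc D c y ≡ true × arc D (ℓ k) y ≡ true)
      common k = adj⇒common-out-neighbour (cℓ k)
      x : Fin (suc j) → Fin n
      x k = proj₁ (common k)
      c→x : ∀ k → arc D c (x k) ≡ true
      c→x k = proj₁ (proj₂ (common k))
      ℓ→x : ∀ k → arc D (ℓ k) (x k) ≡ true
      ℓ→x k = proj₂ (proj₂ (common k))
      x-inj : Injective _≡_ _≡_ x
      x-inj {k} {l} xk≡xl with k ≟ l
      ... | yes k≡l = k≡l
      ... | no  k≢l = contradiction ℓk~ℓl (not-¬ (ℓ≁ℓ k l k≢l))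
        where
        ℓk~ℓl : adj G (ℓ k) (ℓ l) ≡ true
        ℓk~ℓl = common-out-neighbour⇒adj (k≢l ∘ ℓ-inj) (ℓ→x k)
                  (subst (λ y → arc D (ℓ l) y ≡ true) (sym xk≡xl) (ℓ→x l))

corollary2p3 : (i j : ℕ) → 1 ≤ i → 1 ≤ j → (n : ℕ) → (G : Graph n) →
    IsIJCompetitionGraph i j G →
      (edgeCount G * 2 ≤ (i ∸ 1) * i * n)
      × ¬ HasInducedStar G (suc j)
      × (∀ (v : Fin n) → deg G v ≤ j * (i ∸ 1))
corollary2p3 i j _ _ n G (D , ij , G≡C[D]) = edgeCount*2≤ ij , no-induced-star ij , deg≤ ij
  where open CompetitionGraph G D G≡C[D]
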